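{- Let $n\ge 2$. The center number of the even cycle $C_{2n}$ is $cn(C_{2n})=\sum_{k=1}^{\lfloor 4n/3\rfloor}R(2n,k)+1$.
   Context: $d$ is shortest-path distance. For nonempty $S\subseteq V$, $e_S(v)=\max_{x\in S}d(v,x)$ and $C_S(G)=\{v\in V: e_S(v)\le e_S(x)\ \forall x\in V\}$. A set $A\subseteq V$ is a center set of $G$ if $A=C_S(G)$ for some nonempty $S\subseteq V$; the center number $cn(G)$ is the number of distinct center sets of $G$. For $N\ge 4$ and $k\ge 0$, $R(N,k)$ is the number of ways to choose $k$ objects from $N$ circularly arranged objects so that no three objects in three consecutive (cyclic) positions are all chosen. -}

module Defs where

open import Data.Nat using (ℕ; zero; suc; _+_; _*_; _∸_; _⊔_; _⊓_; _≤ᵇ_; _≡ᵇ_; ∣_-_∣)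
open import Data.Nat.DivMod using (_mod_)
open import Data.Bool using (Bool; true; false; _∧_; _∨_; not; if_then_else_)
open import Data.Fin using (Fin; toℕ)
open import Data.Fin.Subset using (Subset; inside; outside; ∣_∣)
open import Data.Vec using (Vec; []; _∷_; lookup; tabulate)
open import Data.Vec.Properties using (≡-dec)
open import Data.Bool.Properties renaming (_≟_ to _≟B_)
open import Data.List using (List; []; _∷_; concatMap; allFin; length; filterᵇ)
open import Data.Bool.ListAction using (all; any)
open import Relation.Nullary.Decidable using (⌊_⌋)

subsets : (n : ℕ) → List (Subset n)
subsets zero = [] ∷ []
subsets (suc n) = concatMap (λ s → (inside ∷ s) ∷ (outside ∷ s) ∷ []) (subsets n)

_∈ᵇ_ : ∀ {N} → Fin N → Subset N → Bool
x ∈ᵇ S = lookup S x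

_≟ˢ_ : ∀ {N} → Subset N → Subset N → Bool
A ≟ˢ B = ⌊ ≡-dec _≟B_ A B ⌋

nonemptyᵇ : ∀ {N} → Subset N → Bool
nonemptyᵇ {N} S = any (λ x → x ∈ᵇ S) (allFin N)

-- The cycle C_N on vertex set Fin N (i adjacent to i ± 1 mod N).
-- Its shortest-path distance: d(i,j) = min(|i-j|, N-|i-j|).
cycleDist : (N : ℕ) → Fin N → Fin N → ℕ
cycleDist N i j = ∣ toℕ i - toℕ j ∣ ⊓ (N ∸ ∣ toℕ i - toℕ j ∣)

-- e_S(v) = max_{x ∈ S} d(v,x)  (used only for nonempty S).
ecc : (N : ℕ) → Subset N → Fin N → ℕ
ecc N S v = go (allFin N)
  where
  go : List (Fin N) → ℕ
  go [] = 0
  go (x ∷ xs) = if x ∈ᵇ S then cycleDist N v x ⊔ go xs else go xs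

centerOf : (N : ℕ) → Subset N → Subset N
centerOf N S = tabulate (λ v → all (λ x → ecc N S v ≤ᵇ ecc N S x) (allFin N))

isCenterSetᵇ : (N : ℕ) → Subset N → Bool
isCenterSetᵇ N A = any (λ S → nonemptyᵇ S ∧ (centerOf N S ≟ˢ A)) (subsets N)

centerNumber : ℕ → ℕ
centerNumber N = length (filterᵇ (isCenterSetᵇ N) (subsets N))

csuc : ∀ {N} → Fin N → Fin N
csuc {suc m} i = (toℕ i + 1) mod (suc m)

noThreeConsecᵇ : ∀ {N} → Subset N → Bool
noThreeConsecᵇ {N} A =
  all (λ i → not ((i ∈ᵇ A) ∧ (csuc i ∈ᵇ A) ∧ (csuc (csuc i) ∈ᵇ A))) (allFin N)

R : ℕ → ℕ → ℕ
R N k = length (filterᵇ (λ A → (∣ A ∣ ≡ᵇ k) ∧ noThreeConsecᵇ A) (subsets N))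

sumFrom1 : ℕ → (ℕ → ℕ) → ℕ
sumFrom1 zero f = 0
sumFrom1 (suc m) f = sumFrom1 m f + f (suc m)

-- On C_2n every vertex v has an antipode v + n, and d(v, x) + d(v, x + n) = n for all v, x.
-- A center set other than V contains no three consecutive vertices: if i, i+1, i+2 are centers
-- and the eccentricity e of i+1 were below n, a point of S at distance e from i+1 would be
-- farther from i or from i+2; so e = n, the largest possible value, and every vertex is a center.
-- Conversely a nonempty A without three consecutive vertices is the center set of the
-- antipodes of its complement: members of A then have eccentricity n - 1, the others n.
-- Summing the indicator of such an A over its three rotations gives 3|A| <= 4n, so the center
-- sets other than V are counted by R(2n, k) for 1 <= k <= floor(4n/3).

module Submission where

open import Defs
open import Data.Nat using (ℕ; _+_; _*_; _≤_; _/_)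
open import Relation.Binary.PropositionalEquality using (_≡_)

open import Data.Bool using (Bool; true; false; T; not; _∧_)
open import Data.Bool.ListAction using (all; any)
open import Data.Bool.Properties using (T-≡; T-∧) renaming (_≟_ to _≟ᴮ_)
open import Data.Empty using (⊥-elim)
open import Data.Fin as Fin using (Fin; toℕ)
open import Data.Fin.Permutation using (Permutation′; permutation)
open import Data.Fin.Properties using (toℕ-fromℕ<; toℕ-injective; toℕ<n)
open import Data.Fin.Subset using (Subset; inside; outside; ∣_∣; _∈_; _∉_; _⊆_; Nonempty; ⊤; ∁; ⁅_⁆)
open import Data.Fin.Subset.Properties
  using (∣p∣≤n; _∈?_; nonempty?; ⊆-antisym; ⊆⊤; ∈⊤; x∈∁p⇒x∉p; x∉p⇒x∈∁p; ∣⁅x⁆∣≡1; x∈⁅y⁆⇒x≡y;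
         p⊆q⇒∣p∣≤∣q∣; Empty-unique; ∣⊥∣≡0; ∣⊤∣≡n; ∣p∣≡n⇒p≡⊤)
open import Data.List using (List; []; _∷_; length; filterᵇ; concatMap; allFin)
open import Data.List.Extrema.Nat using (argmin; f[argmin]≤f[xs])
open import Data.List.Membership.Propositional using (lose) renaming (_∈_ to _∈ˡ_)
open import Data.List.Membership.Propositional.Properties using (∈-allFin)
open import Data.List.Relation.Unary.All as All using ()
open import Data.List.Relation.Unary.All.Properties using (all⁺; all⁻)
open import Data.List.Relation.Unary.Any as Any using (here; there; satisfied)
open import Data.List.Relation.Unary.Any.Properties using (any⁺; any⁻; concatMap⁺)
open import Data.Nat
  using (zero; suc; _∸_; _⊓_; _⊔_; _<_; _≡ᵇ_; _≤ᵇ_; z≤n; s≤s; s≤s⁻¹; ∣_-_∣; _<?_; _≟_;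
         NonZero; >-nonZero; >-nonZero⁻¹)
open import Data.Nat.DivMod
  using (_%_; _mod_; %-distribˡ-+; m%n%n≡m%n; [m+n]%n≡m%n; m<n⇒m%n≡m; m≤n⇒[n∸m]%m≡n%m;
         m*n/n≡m; /-monoˡ-≤)
open import Data.Nat.Properties
open import Algebra.Properties.CommutativeSemigroup +-commutativeSemigroup using (interchange; x∙yz≈y∙xz)
open import Algebra.Properties.CommutativeMonoid.Sum +-0-commutativeMonoid using (sum; ∑-distrib-+; sum-permute)
open import Data.Product as Product using (∃; _×_; _,_; proj₁)
open import Data.Sum as Sum using (_⊎_; inj₁; inj₂)
open import Data.Vec using (_∷_; []; tabulate; lookup)
open import Data.Vec.Properties using ([]=⇒lookup; lookup⇒[]=; lookup∘tabulate; ≡-dec)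
open import Function using (_∘_)
open import Function.Bundles using (Equivalence; _⇔_; mk⇔)
open import Relation.Binary.Definitions using (tri<; tri≈; tri>)
open import Relation.Binary.PropositionalEquality
  using (_≢_; refl; sym; trans; cong; cong₂; subst; subst₂; module ≡-Reasoning)
open import Relation.Nullary using (¬_; yes; no)
open import Relation.Nullary.Decidable using (toWitness; fromWitness; T?; _×-dec_)

-- Indicators, sums over 1..m and counting

𝟙 : Bool → ℕ
𝟙 true  = 1
𝟙 false = 0

𝟙-T : ∀ {b} → T b → 𝟙 b ≡ 1
𝟙-T {true} _ = refl

𝟙-¬T : ∀ {b} → ¬ T b → 𝟙 b ≡ 0
𝟙-¬T {true}  ¬t = ⊥-elim (¬t _)
𝟙-¬T {false} _  = refl

sumFrom1-cong : ∀ m {f g : ℕ → ℕ} → (∀ k → f k ≡ g k) → sumFrom1 m f ≡ sumFrom1 m g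
sumFrom1-cong zero    f≗g = refl
sumFrom1-cong (suc m) f≗g = cong₂ _+_ (sumFrom1-cong m f≗g) (f≗g (suc m))

sumFrom1-distrib-+ : ∀ m (f g : ℕ → ℕ) →
  sumFrom1 m (λ k → f k + g k) ≡ sumFrom1 m f + sumFrom1 m g
sumFrom1-distrib-+ zero    f g = refl
sumFrom1-distrib-+ (suc m) f g =
  trans (cong (_+ (f (suc m) + g (suc m))) (sumFrom1-distrib-+ m f g))
        (interchange (sumFrom1 m f) (sumFrom1 m g) (f (suc m)) (g (suc m)))

sumFrom1-vanish : ∀ m {f : ℕ → ℕ} → (∀ k → 1 ≤ k → k ≤ m → f k ≡ 0) → sumFrom1 m f ≡ 0
sumFrom1-vanish zero    _  = refl
sumFrom1-vanish (suc m) f0 =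
  cong₂ _+_ (sumFrom1-vanish m (λ k 1≤k k≤m → f0 k 1≤k (m≤n⇒m≤1+n k≤m))) (f0 (suc m) (s≤s z≤n) ≤-refl)

sumFrom1-δ : ∀ m {a} {f : ℕ → ℕ} → 1 ≤ a → a ≤ m → (∀ k → k ≢ a → f k ≡ 0) → sumFrom1 m f ≡ f a
sumFrom1-δ zero    (s≤s _) ()
sumFrom1-δ (suc m) {a} {f} 1≤a a≤1+m f0 with m≤n⇒m<n∨m≡n a≤1+m
... | inj₁ a<1+m = trans (cong₂ _+_ (sumFrom1-δ m 1≤a (s≤s⁻¹ a<1+m) f0) (f0 (suc m) (<⇒≢ a<1+m ∘ sym)))
                         (+-identityʳ (f a))
... | inj₂ refl  = cong (_+ f (suc m)) (sumFrom1-vanish m (λ k _ k≤m → f0 k (<⇒≢ (s≤s k≤m))))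

countᵇ : ∀ {A : Set} → (A → Bool) → List A → ℕ
countᵇ p xs = length (filterᵇ p xs)

countᵇ-∷ : ∀ {A : Set} (p : A → Bool) x xs → countᵇ p (x ∷ xs) ≡ 𝟙 (p x) + countᵇ p xs
countᵇ-∷ p x xs with p x
... | true  = refl
... | false = refl

countᵇ-decompose : ∀ {A : Set} (p q : A → Bool) (r : ℕ → A → Bool) m →
  (∀ x → 𝟙 (p x) ≡ 𝟙 (q x) + sumFrom1 m (λ k → 𝟙 (r k x))) →
  ∀ xs → countᵇ p xs ≡ countᵇ q xs + sumFrom1 m (λ k → countᵇ (r k) xs)
countᵇ-decompose p q r m split []       = sym (sumFrom1-vanish m (λ _ _ _ → refl))
countᵇ-decompose p q r m split (x ∷ xs) = begin
  countᵇ p (x ∷ xs)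
    ≡⟨ countᵇ-∷ p x xs ⟩
  𝟙 (p x) + countᵇ p xs
    ≡⟨ cong₂ _+_ (split x) (countᵇ-decompose p q r m split xs) ⟩
  (𝟙 (q x) + sumFrom1 m (λ k → 𝟙 (r k x))) + (countᵇ q xs + sumFrom1 m (λ k → countᵇ (r k) xs))
    ≡⟨ interchange (𝟙 (q x)) _ (countᵇ q xs) _ ⟩
  (𝟙 (q x) + countᵇ q xs) + (sumFrom1 m (λ k → 𝟙 (r k x)) + sumFrom1 m (λ k → countᵇ (r k) xs))
    ≡⟨ cong₂ _+_ (countᵇ-∷ q x xs) (sumFrom1-distrib-+ m _ _) ⟨
  countᵇ q (x ∷ xs) + sumFrom1 m (λ k → 𝟙 (r k x) + countᵇ (r k) xs)
    ≡⟨ cong (countᵇ q (x ∷ xs) +_) (sumFrom1-cong m (λ k → countᵇ-∷ (r k) x xs)) ⟨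
  countᵇ q (x ∷ xs) + sumFrom1 m (λ k → countᵇ (r k) (x ∷ xs)) ∎
  where open ≡-Reasoning

countᵇ-full-subsets : ∀ N → countᵇ (λ A → ∣ A ∣ ≡ᵇ N) (subsets N) ≡ 1
countᵇ-full-subsets zero    = refl
countᵇ-full-subsets (suc N) = trans (extend (subsets N)) (countᵇ-full-subsets N)
  where
  open ≡-Reasoning
  full : ∀ {M} → Subset M → Bool
  full {M} A = ∣ A ∣ ≡ᵇ M
  extend : ∀ As → countᵇ full (concatMap (λ A → (inside ∷ A) ∷ (outside ∷ A) ∷ []) As) ≡ countᵇ full As
  extend []       = refl
  extend (A ∷ As) = begin
    countᵇ full ((inside ∷ A) ∷ (outside ∷ A) ∷ rest)
      ≡⟨ countᵇ-∷ full (inside ∷ A) _ ⟩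
    𝟙 (full A) + countᵇ full ((outside ∷ A) ∷ rest)
      ≡⟨ cong (𝟙 (full A) +_) (trans (countᵇ-∷ full (outside ∷ A) rest)
                                      (cong₂ _+_ (𝟙-¬T (<⇒≢ (s≤s (∣p∣≤n A)) ∘ ≡ᵇ⇒≡ _ _)) (extend As))) ⟩
    𝟙 (full A) + countᵇ full As
      ≡⟨ countᵇ-∷ full A As ⟨
    countᵇ full (A ∷ As) ∎
    where rest = concatMap (λ A → (inside ∷ A) ∷ (outside ∷ A) ∷ []) As

∈⇒∈ᵇ : ∀ {N} {x : Fin N} {p : Subset N} → x ∈ p → T (x ∈ᵇ p)
∈⇒∈ᵇ x∈p = Equivalence.from T-≡ ([]=⇒lookup x∈p)

∈ᵇ⇒∈ : ∀ {N} {x : Fin N} {p : Subset N} → T (x ∈ᵇ p) → x ∈ p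
∈ᵇ⇒∈ {x = x} {p} t = lookup⇒[]= x p (Equivalence.to T-≡ t)

∈-tabulate⁺ : ∀ {N} {f : Fin N → Bool} {x} → T (f x) → x ∈ tabulate f
∈-tabulate⁺ {f = f} {x} t = ∈ᵇ⇒∈ (subst T (sym (lookup∘tabulate f x)) t)

∈-tabulate⁻ : ∀ {N} {f : Fin N → Bool} {x} → x ∈ tabulate f → T (f x)
∈-tabulate⁻ {f = f} {x} x∈ = subst T (lookup∘tabulate f x) (∈⇒∈ᵇ x∈)

module _ {N : ℕ} (p : Fin N → Bool) where

  all-allFin⁺ : (∀ x → T (p x)) → T (all p (allFin N))
  all-allFin⁺ h = all⁻ p {allFin N} (All.tabulate (λ {x} _ → h x))

  all-allFin⁻ : T (all p (allFin N)) → ∀ x → T (p x)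
  all-allFin⁻ t x = All.lookup (all⁺ p (allFin N) t) (∈-allFin x)

  any-allFin⁺ : ∀ {x} → T (p x) → T (any p (allFin N))
  any-allFin⁺ {x} t = any⁺ p (lose (∈-allFin x) t)

  any-allFin⁻ : T (any p (allFin N)) → ∃ (T ∘ p)
  any-allFin⁻ t = satisfied (any⁻ p (allFin N) t)

nonempty⇒∣p∣>0 : ∀ {N} {A : Subset N} → Nonempty A → 0 < ∣ A ∣
nonempty⇒∣p∣>0 {A = A} (x , x∈A) = ≤-trans (≤-reflexive (sym (∣⁅x⁆∣≡1 x))) (p⊆q⇒∣p∣≤∣q∣ ⁅x⁆⊆A)
  where
  ⁅x⁆⊆A : ⁅ x ⁆ ⊆ A
  ⁅x⁆⊆A y∈⁅x⁆ = subst (_∈ A) (sym (x∈⁅y⁆⇒x≡y x y∈⁅x⁆)) x∈A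

∣p∣>0⇒nonempty : ∀ {N} {A : Subset N} → 0 < ∣ A ∣ → Nonempty A
∣p∣>0⇒nonempty {N} {A} ∣A∣>0 with nonempty? A
... | yes ne = ne
... | no  ¬ne = ⊥-elim (<⇒≢ ∣A∣>0 (sym (trans (cong ∣_∣ (Empty-unique ¬ne)) (∣⊥∣≡0 N))))

nonemptyᵇ⁺ : ∀ {N} {S : Subset N} → Nonempty S → T (nonemptyᵇ S)
nonemptyᵇ⁺ {S = S} (_ , x∈S) = any-allFin⁺ (_∈ᵇ S) (∈⇒∈ᵇ x∈S)

nonemptyᵇ⁻ : ∀ {N} {S : Subset N} → T (nonemptyᵇ S) → Nonempty S
nonemptyᵇ⁻ {S = S} t = Product.map₂ ∈ᵇ⇒∈ (any-allFin⁻ (_∈ᵇ S) t)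

∈-subsets : ∀ {N} (A : Subset N) → A ∈ˡ subsets N
∈-subsets []      = here refl
∈-subsets (b ∷ A) = concatMap⁺ _ (Any.map (λ { refl → extension b }) (∈-subsets A))
  where
  extension : ∀ b → (b ∷ A) ∈ˡ ((inside ∷ A) ∷ (outside ∷ A) ∷ [])
  extension true  = here refl
  extension false = there (here refl)

isCenterSetᵇ⁺ : ∀ {N} {S A : Subset N} → Nonempty S → centerOf N S ≡ A → T (isCenterSetᵇ N A)
isCenterSetᵇ⁺ {S = S} ne refl =
  any⁺ _ (lose (∈-subsets S) (Equivalence.from T-∧ (nonemptyᵇ⁺ ne , fromWitness refl)))

isCenterSetᵇ⁻ : ∀ {N} {A : Subset N} → T (isCenterSetᵇ N A) → ∃ λ S → Nonempty S × centerOf N S ≡ A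
isCenterSetᵇ⁻ {N} t with satisfied (any⁻ _ (subsets N) t)
... | S , h with Equivalence.to T-∧ h
...   | ne , eq = S , nonemptyᵇ⁻ ne , toWitness eq

-- Eccentricities and centers

-- `ecc` folds a `where`-bound function over `allFin N`, which cannot be named directly; checking
-- ecc≡eccFold makes unification define eccFold as that function, so that `ecc N S v` unfolds to
-- `eccFold N S v (allFin N)`.
mutual
  eccFold : (N : ℕ) → Subset N → Fin N → List (Fin N) → ℕ
  eccFold = _

  ecc≡eccFold : ∀ N S v → ecc N S v ≡ eccFold N S v (allFin N)
  ecc≡eccFold N S v with allFin N
  ... | xs = refl

module _ {N : ℕ} (S : Subset N) (v : Fin N) where

  eccFold-upper : ∀ {x} xs → x ∈ˡ xs → x ∈ S → cycleDist N v x ≤ eccFold N S v xs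
  eccFold-upper (x ∷ xs) (here refl) x∈S rewrite []=⇒lookup x∈S = m≤m⊔n _ _
  eccFold-upper (y ∷ xs) (there x∈xs) x∈S with lookup S y
  ... | true  = ≤-trans (eccFold-upper xs x∈xs x∈S) (m≤n⊔m _ _)
  ... | false = eccFold-upper xs x∈xs x∈S

  eccFold-least : ∀ {b} → (∀ x → x ∈ S → cycleDist N v x ≤ b) → ∀ xs → eccFold N S v xs ≤ b
  eccFold-least h []       = z≤n
  eccFold-least h (x ∷ xs) with lookup S x in eq
  ... | true  = ⊔-lub (h x (lookup⇒[]= x S eq)) (eccFold-least h xs)
  ... | false = eccFold-least h xs

  eccFold-attained : Nonempty S → ∀ xs → ∃ λ y → y ∈ S × eccFold N S v xs ≤ cycleDist N v y
  eccFold-attained (y , y∈S) []       = y , y∈S , z≤n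
  eccFold-attained ne        (x ∷ xs) with lookup S x in eq | eccFold-attained ne xs
  ... | false | r = r
  ... | true  | y , y∈S , le with ≤-total (cycleDist N v x) (cycleDist N v y)
  ...   | inj₁ dx≤dy = y , y∈S , ⊔-lub dx≤dy le
  ...   | inj₂ dy≤dx = x , lookup⇒[]= x S eq , ⊔-lub ≤-refl (≤-trans le dy≤dx)

  ecc-upper : ∀ {x} → x ∈ S → cycleDist N v x ≤ ecc N S v
  ecc-upper {x} x∈S = eccFold-upper (allFin N) (∈-allFin x) x∈S

  ecc-least : ∀ {b} → (∀ x → x ∈ S → cycleDist N v x ≤ b) → ecc N S v ≤ b
  ecc-least h = eccFold-least h (allFin N)

  ecc-attained : Nonempty S → ∃ λ y → y ∈ S × ecc N S v ≡ cycleDist N v y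
  ecc-attained ne with eccFold-attained ne (allFin N)
  ... | y , y∈S , le = y , y∈S , ≤-antisym le (ecc-upper y∈S)

module _ {N : ℕ} (S : Subset N) where

  centerOf⁺ : ∀ {v} → (∀ x → ecc N S v ≤ ecc N S x) → v ∈ centerOf N S
  centerOf⁺ {v} h = ∈-tabulate⁺ (all-allFin⁺ _ (λ x → ≤⇒≤ᵇ (h x)))

  centerOf⁻ : ∀ {v} → v ∈ centerOf N S → ∀ x → ecc N S v ≤ ecc N S x
  centerOf⁻ {v} v∈C x = ≤ᵇ⇒≤ _ _ (all-allFin⁻ (λ x → ecc N S v ≤ᵇ ecc N S x) (∈-tabulate⁻ v∈C) x)

  centerOf-nonempty : Fin N → Nonempty (centerOf N S)
  centerOf-nonempty v₀ =
    v , centerOf⁺ (λ x → All.lookup (f[argmin]≤f[xs] {f = ecc N S} v₀ (allFin N)) (∈-allFin x))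
    where v = argmin (ecc N S) v₀ (allFin N)

centerOf≡minimisers : ∀ {N} {S A : Subset N} {c} → Nonempty A →
  (∀ {v} → v ∈ A → ecc N S v ≡ c) → (∀ {v} → v ∉ A → c < ecc N S v) → centerOf N S ≡ A
centerOf≡minimisers {N} {S} {A} {c} (a , a∈A) on off = ⊆-antisym C⊆A A⊆C
  where
  c≤ecc : ∀ x → c ≤ ecc N S x
  c≤ecc x with x ∈? A
  ... | yes x∈A = ≤-reflexive (sym (on x∈A))
  ... | no  x∉A = <⇒≤ (off x∉A)
  A⊆C : A ⊆ centerOf N S
  A⊆C v∈A = centerOf⁺ S (λ x → subst (_≤ ecc N S x) (sym (on v∈A)) (c≤ecc x))
  C⊆A : centerOf N S ⊆ A
  C⊆A {v} v∈C with v ∈? A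
  ... | yes v∈A = v∈A
  ... | no  v∉A = ⊥-elim (<⇒≱ (off v∉A) (subst (ecc N S v ≤_) (on a∈A) (centerOf⁻ S v∈C a)))

-- Cyclic shifts and distance on the cycle

[m%d+n]%d≡[m+n]%d : ∀ m n d .{{_ : NonZero d}} → (m % d + n) % d ≡ (m + n) % d
[m%d+n]%d≡[m+n]%d m n d = begin
  (m % d + n) % d          ≡⟨ %-distribˡ-+ (m % d) n d ⟩
  (m % d % d + n % d) % d  ≡⟨ cong (λ z → (z + n % d) % d) (m%n%n≡m%n m d) ⟩
  (m % d + n % d) % d      ≡⟨ %-distribˡ-+ m n d ⟨
  (m + n) % d              ∎
  where open ≡-Reasoning

[m+n%d]%d≡[m+n]%d : ∀ m n d .{{_ : NonZero d}} → (m + n % d) % d ≡ (m + n) % d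
[m+n%d]%d≡[m+n]%d m n d = begin
  (m + n % d) % d  ≡⟨ cong (_% d) (+-comm m (n % d)) ⟩
  (n % d + m) % d  ≡⟨ [m%d+n]%d≡[m+n]%d n m d ⟩
  (n + m) % d      ≡⟨ cong (_% d) (+-comm n m) ⟩
  (m + n) % d      ∎
  where open ≡-Reasoning

-- `cycleDist N i j` unfolds to `minArc N ∣ toℕ i - toℕ j ∣`.
minArc : ℕ → ℕ → ℕ
minArc N k = k ⊓ (N ∸ k)

minArc-reflect : ∀ N {k} → k ≤ N → minArc N (N ∸ k) ≡ minArc N k
minArc-reflect N {k} k≤N = trans (cong ((N ∸ k) ⊓_) (m∸[m∸n]≡n k≤N)) (⊓-comm (N ∸ k) k)

minArc-pos : ∀ N {k} → 0 < k → k < N → 0 < minArc N k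
minArc-pos N 0<k k<N = ⊓-glb 0<k (m<n⇒0<n∸m k<N)

module _ {N : ℕ} .{{_ : NonZero N}} where

  infixl 6 _⊕_
  _⊕_ : Fin N → ℕ → Fin N
  i ⊕ k = (toℕ i + k) mod N

  toℕ-⊕ : ∀ i k → toℕ (i ⊕ k) ≡ (toℕ i + k) % N
  toℕ-⊕ i k = toℕ-fromℕ< _

  ⊕-assoc : ∀ i k l → i ⊕ k ⊕ l ≡ i ⊕ (k + l)
  ⊕-assoc i k l = toℕ-injective (begin
    toℕ (i ⊕ k ⊕ l)            ≡⟨ toℕ-⊕ (i ⊕ k) l ⟩
    (toℕ (i ⊕ k) + l) % N      ≡⟨ cong (λ z → (z + l) % N) (toℕ-⊕ i k) ⟩
    ((toℕ i + k) % N + l) % N  ≡⟨ [m%d+n]%d≡[m+n]%d (toℕ i + k) l N ⟩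
    (toℕ i + k + l) % N        ≡⟨ cong (_% N) (+-assoc (toℕ i) k l) ⟩
    (toℕ i + (k + l)) % N      ≡⟨ toℕ-⊕ i (k + l) ⟨
    toℕ (i ⊕ (k + l))          ∎)
    where open ≡-Reasoning

  toℕ-⊕-small : ∀ i {k} → toℕ i + k < N → toℕ (i ⊕ k) ≡ toℕ i + k
  toℕ-⊕-small i {k} no-wrap = trans (toℕ-⊕ i k) (m<n⇒m%n≡m no-wrap)

  ⊕-identityʳ : ∀ i → i ⊕ 0 ≡ i
  ⊕-identityʳ i = toℕ-injective (trans (toℕ-⊕-small i i+0<N) (+-identityʳ (toℕ i)))
    where
    i+0<N : toℕ i + 0 < N
    i+0<N = subst (_< N) (sym (+-identityʳ (toℕ i))) (toℕ<n i)

  ⊕-period : ∀ i → i ⊕ N ≡ i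
  ⊕-period i = toℕ-injective (begin
    toℕ (i ⊕ N)      ≡⟨ toℕ-⊕ i N ⟩
    (toℕ i + N) % N  ≡⟨ [m+n]%n≡m%n (toℕ i) N ⟩
    toℕ i % N        ≡⟨ m<n⇒m%n≡m (toℕ<n i) ⟩
    toℕ i            ∎)
    where open ≡-Reasoning

  ⊕-inverse : ∀ i {k l} → k + l ≡ N → i ⊕ k ⊕ l ≡ i
  ⊕-inverse i {k} {l} k+l≡N = trans (⊕-assoc i k l) (trans (cong (i ⊕_) k+l≡N) (⊕-period i))

  ⊕-offset : ∀ i j → ∃ λ k → k < N × i ⊕ k ≡ j
  ⊕-offset i j = toℕ (j ⊕ t) , toℕ<n (j ⊕ t) , toℕ-injective (begin
    toℕ (i ⊕ toℕ (j ⊕ t))          ≡⟨ toℕ-⊕ i _ ⟩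
    (toℕ i + toℕ (j ⊕ t)) % N      ≡⟨ cong (λ z → (toℕ i + z) % N) (toℕ-⊕ j t) ⟩
    (toℕ i + (toℕ j + t) % N) % N  ≡⟨ [m+n%d]%d≡[m+n]%d (toℕ i) (toℕ j + t) N ⟩
    (toℕ i + (toℕ j + t)) % N      ≡⟨ cong (_% N) (x∙yz≈y∙xz (toℕ i) (toℕ j) t) ⟩
    (toℕ j + (toℕ i + t)) % N      ≡⟨ cong (λ z → (toℕ j + z) % N) (m+[n∸m]≡n (<⇒≤ (toℕ<n i))) ⟩
    (toℕ j + N) % N                ≡⟨ [m+n]%n≡m%n (toℕ j) N ⟩
    toℕ j % N                      ≡⟨ m<n⇒m%n≡m (toℕ<n j) ⟩
    toℕ j                          ∎)
    where
    open ≡-Reasoning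
    t = N ∸ toℕ i

  predecessor : Fin N → Fin N
  predecessor i = i ⊕ (N ∸ 1)

  predecessor-⊕1 : ∀ i → predecessor i ⊕ 1 ≡ i
  predecessor-⊕1 i = ⊕-inverse i (m∸n+n≡m (>-nonZero⁻¹ N))

  ⊕1-predecessor : ∀ i → predecessor (i ⊕ 1) ≡ i
  ⊕1-predecessor i = ⊕-inverse i (m+[n∸m]≡n (>-nonZero⁻¹ N))

  toℕ-⊕-wrap : ∀ i {k} → k < N → N ≤ toℕ i + k → toℕ (i ⊕ k) + (N ∸ k) ≡ toℕ i
  toℕ-⊕-wrap i {k} k<N wrap = +-cancelʳ-≡ k _ _ (begin
    toℕ (i ⊕ k) + (N ∸ k) + k    ≡⟨ +-assoc (toℕ (i ⊕ k)) (N ∸ k) k ⟩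
    toℕ (i ⊕ k) + (N ∸ k + k)    ≡⟨ cong₂ _+_ b≡ (m∸n+n≡m (<⇒≤ k<N)) ⟩
    b + N                        ≡⟨ +-comm b N ⟩
    N + b                        ≡⟨ m+[n∸m]≡n wrap ⟩
    toℕ i + k                    ∎)
    where
    open ≡-Reasoning
    b = toℕ i + k ∸ N
    b<N : b < N
    b<N = m<n+o⇒m∸n<o (toℕ i + k) N (+-mono-< (toℕ<n i) k<N)
    b≡ : toℕ (i ⊕ k) ≡ b
    b≡ = trans (toℕ-⊕ i k) (trans (sym (m≤n⇒[n∸m]%m≡n%m wrap)) (m<n⇒m%n≡m b<N))

  cycleDist-⊕ : ∀ i {k} → k < N → cycleDist N i (i ⊕ k) ≡ minArc N k
  cycleDist-⊕ i {k} k<N with toℕ i + k <? N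
  ... | yes no-wrap = cong (minArc N) (begin
    ∣ toℕ i - toℕ (i ⊕ k) ∣  ≡⟨ cong ∣ toℕ i -_∣ (toℕ-⊕-small i no-wrap) ⟩
    ∣ toℕ i - toℕ i + k ∣    ≡⟨ ∣m-m+n∣≡n (toℕ i) k ⟩
    k                        ∎)
    where open ≡-Reasoning
  ... | no  ¬no-wrap = begin
    minArc N ∣ toℕ i - b ∣
      ≡⟨ cong (λ a → minArc N ∣ a - b ∣) (toℕ-⊕-wrap i k<N (≮⇒≥ ¬no-wrap)) ⟨
    minArc N ∣ b + (N ∸ k) - b ∣
      ≡⟨ cong (minArc N) (∣-∣-comm (b + (N ∸ k)) b) ⟩
    minArc N ∣ b - b + (N ∸ k) ∣
      ≡⟨ cong (minArc N) (∣m-m+n∣≡n b (N ∸ k)) ⟩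
    minArc N (N ∸ k)
      ≡⟨ minArc-reflect N (<⇒≤ k<N) ⟩
    minArc N k ∎
    where
    open ≡-Reasoning
    b = toℕ (i ⊕ k)

-- Sets without three cyclically consecutive elements

not-∧³⁺ : ∀ a b c → ¬ (T a × T b × T c) → T (not (a ∧ b ∧ c))
not-∧³⁺ true  true  true  ¬abc = ¬abc _
not-∧³⁺ true  true  false _    = _
not-∧³⁺ true  false _     _    = _
not-∧³⁺ false _     _     _    = _

not-∧³⁻ : ∀ a b c → T (not (a ∧ b ∧ c)) → ¬ T a ⊎ ¬ T b ⊎ ¬ T c
not-∧³⁻ false _     _     _ = inj₁ λ ()
not-∧³⁻ true  false _     _ = inj₂ (inj₁ λ ())
not-∧³⁻ true  true  false _ = inj₂ (inj₂ λ ())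

-- Matching N against `suc _` lets `csuc i` compute to `i ⊕ 1`.
noThreeConsecᵇ⁺ : ∀ {N} .{{_ : NonZero N}} {A : Subset N} →
  (∀ i → ¬ (i ∈ A × i ⊕ 1 ∈ A × i ⊕ 1 ⊕ 1 ∈ A)) → T (noThreeConsecᵇ A)
noThreeConsecᵇ⁺ {zero}  _ = _
noThreeConsecᵇ⁺ {suc _} h =
  all-allFin⁺ _ (λ i → not-∧³⁺ _ _ _ λ (a , b , c) → h i (∈ᵇ⇒∈ a , ∈ᵇ⇒∈ b , ∈ᵇ⇒∈ c))

noThreeConsecᵇ-window : ∀ {N} .{{_ : NonZero N}} {A : Subset N} → T (noThreeConsecᵇ A) →
  ∀ i → T (not (i ∈ᵇ A ∧ (i ⊕ 1) ∈ᵇ A ∧ (i ⊕ 1 ⊕ 1) ∈ᵇ A))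
noThreeConsecᵇ-window {suc _} t = all-allFin⁻ _ t

noThreeConsecᵇ⁻ : ∀ {N} .{{_ : NonZero N}} {A : Subset N} → T (noThreeConsecᵇ A) →
  ∀ i → i ∉ A ⊎ i ⊕ 1 ∉ A ⊎ i ⊕ 1 ⊕ 1 ∉ A
noThreeConsecᵇ⁻ {A = A} t i =
  Sum.map (_∘ ∈⇒∈ᵇ) (Sum.map (_∘ ∈⇒∈ᵇ) (_∘ ∈⇒∈ᵇ))
          (not-∧³⁻ _ _ _ (noThreeConsecᵇ-window {A = A} t i))

𝟙≤1 : ∀ b → 𝟙 b ≤ 1
𝟙≤1 true  = ≤-refl
𝟙≤1 false = z≤n

𝟙-window : ∀ a b c → T (not (a ∧ b ∧ c)) → 𝟙 a + 𝟙 b + 𝟙 c ≤ 2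
𝟙-window false b     c     _ = +-mono-≤ (𝟙≤1 b) (𝟙≤1 c)
𝟙-window true  false c     _ = s≤s (𝟙≤1 c)
𝟙-window true  true  false _ = ≤-refl

∣p∣≡∑𝟙 : ∀ {N} (A : Subset N) → ∣ A ∣ ≡ sum (λ i → 𝟙 (i ∈ᵇ A))
∣p∣≡∑𝟙 []          = refl
∣p∣≡∑𝟙 (true ∷ A)  = cong suc (∣p∣≡∑𝟙 A)
∣p∣≡∑𝟙 (false ∷ A) = ∣p∣≡∑𝟙 A

sum≤N*c : ∀ {N} {f : Fin N → ℕ} {c} → (∀ i → f i ≤ c) → sum f ≤ N * c
sum≤N*c {zero}  _   = z≤n
sum≤N*c {suc N} f≤c = +-mono-≤ (f≤c Fin.zero) (sum≤N*c (f≤c ∘ Fin.suc))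

module _ {N : ℕ} .{{_ : NonZero N}} where

  rotation : Permutation′ N
  rotation = permutation (_⊕ 1) predecessor predecessor-⊕1 ⊕1-predecessor

  sum-rotate : ∀ (g : Fin N → ℕ) → sum (λ i → g (i ⊕ 1)) ≡ sum g
  sum-rotate g = sym (sum-permute g rotation)

  noThreeConsec⇒3∣A∣≤2N : ∀ {A : Subset N} → T (noThreeConsecᵇ A) → 3 * ∣ A ∣ ≤ 2 * N
  noThreeConsec⇒3∣A∣≤2N {A} t = begin
    3 * ∣ A ∣
      ≡⟨ cong (3 *_) (∣p∣≡∑𝟙 A) ⟩
    sum g + (sum g + (sum g + 0))
      ≡⟨ cong (λ z → sum g + (sum g + z)) (+-identityʳ (sum g)) ⟩
    sum g + (sum g + sum g)
      ≡⟨ +-assoc (sum g) (sum g) (sum g) ⟨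
    sum g + sum g + sum g
      ≡⟨ cong₂ (λ y z → sum g + y + z) (sum-rotate g) (trans (sum-rotate (g ∘ (_⊕ 1))) (sum-rotate g)) ⟨
    sum g + sum (λ i → g (i ⊕ 1)) + sum (λ i → g (i ⊕ 1 ⊕ 1))
      ≡⟨ cong (_+ sum (λ i → g (i ⊕ 1 ⊕ 1))) (∑-distrib-+ g (λ i → g (i ⊕ 1))) ⟨
    sum (λ i → g i + g (i ⊕ 1)) + sum (λ i → g (i ⊕ 1 ⊕ 1))
      ≡⟨ ∑-distrib-+ (λ i → g i + g (i ⊕ 1)) (λ i → g (i ⊕ 1 ⊕ 1)) ⟨
    sum (λ i → g i + g (i ⊕ 1) + g (i ⊕ 1 ⊕ 1))
      ≤⟨ sum≤N*c (λ i → 𝟙-window (i ∈ᵇ A) _ _ (noThreeConsecᵇ-window {A = A} t i)) ⟩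
    N * 2
      ≡⟨ *-comm N 2 ⟩
    2 * N ∎
    where
    open ≤-Reasoning
    g : Fin N → ℕ
    g i = 𝟙 (i ∈ᵇ A)

module EvenCycle (n : ℕ) .{{_ : NonZero n}} where

  N : ℕ
  N = 2 * n

  instance
    N-nonZero : NonZero N
    N-nonZero = m*n≢0 2 n

  N≡n+n : N ≡ n + n
  N≡n+n = cong (n +_) (+-identityʳ n)

  N∸n≡n : N ∸ n ≡ n
  N∸n≡n = trans (cong (_∸ n) N≡n+n) (m+n∸n≡m n n)

  n<N : n < N
  n<N = subst (n <_) (sym N≡n+n) (m<m+n n (>-nonZero⁻¹ n))

  minArc-small : ∀ {k} → k ≤ n → minArc N k ≡ k
  minArc-small {k} k≤n = m≤n⇒m⊓n≡m (≤-trans k≤n (subst (_≤ N ∸ k) N∸n≡n (∸-monoʳ-≤ N k≤n)))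

  N∸k≤n : ∀ {k} → n ≤ k → N ∸ k ≤ n
  N∸k≤n {k} n≤k = subst (N ∸ k ≤_) N∸n≡n (∸-monoʳ-≤ N n≤k)

  minArc-large : ∀ {k} → n ≤ k → minArc N k ≡ N ∸ k
  minArc-large n≤k = m≥n⇒m⊓n≡n (≤-trans (N∸k≤n n≤k) n≤k)

  minArc≤n : ∀ k → minArc N k ≤ n
  minArc≤n k with ≤-total k n
  ... | inj₁ k≤n = subst (_≤ n) (sym (minArc-small k≤n)) k≤n
  ... | inj₂ n≤k = subst (_≤ n) (sym (minArc-large n≤k)) (N∸k≤n n≤k)

  d : Fin N → Fin N → ℕ
  d = cycleDist N

  d-sym : ∀ i j → d i j ≡ d j i
  d-sym i j = cong (minArc N) (∣-∣-comm (toℕ i) (toℕ j))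

  d≤n : ∀ i j → d i j ≤ n
  d≤n i j = minArc≤n ∣ toℕ i - toℕ j ∣

  d-pos : ∀ {i j} → i ≢ j → 0 < d i j
  d-pos {i} {j} i≢j with ⊕-offset i j
  ... | zero  , _   , i⊕0≡j = ⊥-elim (i≢j (trans (sym (⊕-identityʳ i)) i⊕0≡j))
  ... | suc k , k<N , refl  = subst (0 <_) (sym (cycleDist-⊕ i k<N)) (minArc-pos N (s≤s z≤n) k<N)

  d-⊕1 : ∀ v → d v (v ⊕ 1) ≡ 1
  d-⊕1 v = trans (cycleDist-⊕ v (≤-<-trans (>-nonZero⁻¹ n) n<N)) (minArc-small (>-nonZero⁻¹ n))

  antipode : Fin N → Fin N
  antipode x = x ⊕ n

  antipode-involutive : ∀ x → antipode (antipode x) ≡ x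
  antipode-involutive x = ⊕-inverse x (sym N≡n+n)

  d-antipode : ∀ x → d x (antipode x) ≡ n
  d-antipode x = trans (cycleDist-⊕ x n<N) (minArc-small ≤-refl)

  d+d-antipode-near : ∀ v {k} → k < n → d v (v ⊕ k) + d v (antipode (v ⊕ k)) ≡ n
  d+d-antipode-near v {k} k<n = begin
    d v (v ⊕ k) + d v (v ⊕ k ⊕ n)       ≡⟨ cong (λ y → d v (v ⊕ k) + d v y) (⊕-assoc v k n) ⟩
    d v (v ⊕ k) + d v (v ⊕ (k + n))     ≡⟨ cong₂ _+_ (cycleDist-⊕ v (<-trans k<n n<N)) (cycleDist-⊕ v k+n<N) ⟩
    minArc N k + minArc N (k + n)       ≡⟨ cong₂ _+_ (minArc-small (<⇒≤ k<n)) (minArc-large (m≤n+m n k)) ⟩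
    k + (N ∸ (k + n))                   ≡⟨ cong (λ z → k + (z ∸ (k + n))) N≡n+n ⟩
    k + (n + n ∸ (k + n))               ≡⟨ cong (λ z → k + (n + n ∸ z)) (+-comm k n) ⟩
    k + (n + n ∸ (n + k))               ≡⟨ cong (k +_) ([m+n]∸[m+o]≡n∸o n n k) ⟩
    k + (n ∸ k)                         ≡⟨ m+[n∸m]≡n (<⇒≤ k<n) ⟩
    n                                   ∎
    where
    open ≡-Reasoning
    k+n<N : k + n < N
    k+n<N = subst (k + n <_) (sym N≡n+n) (+-monoˡ-< n k<n)

  d+d-antipode : ∀ v x → d v x + d v (antipode x) ≡ n
  d+d-antipode v x with ⊕-offset v x
  ... | k , k<N , refl with k <? n
  ...   | yes k<n = d+d-antipode-near v k<n
  ...   | no  k≮n = begin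
    d v (v ⊕ k) + d v (antipode (v ⊕ k))             ≡⟨ cong (λ x → d v x + d v (antipode x)) antipode-y ⟨
    d v (antipode y) + d v (antipode (antipode y))   ≡⟨ cong (λ z → d v (antipode y) + d v z) (antipode-involutive y) ⟩
    d v (antipode y) + d v y                         ≡⟨ +-comm (d v (antipode y)) (d v y) ⟩
    d v y + d v (antipode y)                         ≡⟨ d+d-antipode-near v m<n ⟩
    n                                                ∎
    where
    open ≡-Reasoning
    m = k ∸ n
    y = v ⊕ m
    m<n : m < n
    m<n = m<n+o⇒m∸n<o k n (subst (k <_) N≡n+n k<N)
    antipode-y : antipode y ≡ v ⊕ k
    antipode-y = trans (⊕-assoc v m n) (cong (v ⊕_) (m∸n+n≡m (≮⇒≥ k≮n)))

  farther-neighbour : ∀ u x → d (u ⊕ 1) x < n → d (u ⊕ 1) x < d u x ⊎ d (u ⊕ 1) x < d (u ⊕ 1 ⊕ 1) x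
  farther-neighbour u x d<n with ⊕-offset (u ⊕ 1) x
  ... | k , k<N , refl with <-cmp k n
  ...   | tri< k<n _ _ = inj₁ (begin-strict
    d (u ⊕ 1) (u ⊕ 1 ⊕ k)   ≡⟨ cycleDist-⊕ (u ⊕ 1) k<N ⟩
    minArc N k              ≡⟨ minArc-small (<⇒≤ k<n) ⟩
    k                       <⟨ n<1+n k ⟩
    suc k                   ≡⟨ minArc-small k<n ⟨
    minArc N (suc k)        ≡⟨ cycleDist-⊕ u (≤-<-trans k<n n<N) ⟨
    d u (u ⊕ suc k)         ≡⟨ cong (d u) (⊕-assoc u 1 k) ⟨
    d u (u ⊕ 1 ⊕ k)         ∎)
    where open ≤-Reasoning
  ...   | tri≈ _ refl _ = ⊥-elim (<-irrefl (d-antipode (u ⊕ 1)) d<n)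
  ...   | tri> _ _ n<k with m≤n⇒∃[o]m+o≡n n<k
  ...     | j , refl = inj₂ (begin-strict
    d (u ⊕ 1) (u ⊕ 1 ⊕ suc (n + j))        ≡⟨ cycleDist-⊕ (u ⊕ 1) k<N ⟩
    minArc N (suc (n + j))                 ≡⟨ minArc-large (<⇒≤ n<k) ⟩
    N ∸ suc (n + j)                        <⟨ ∸-monoʳ-< (n<1+n (n + j)) (<⇒≤ k<N) ⟩
    N ∸ (n + j)                            ≡⟨ minArc-large (m≤m+n n j) ⟨
    minArc N (n + j)                       ≡⟨ cycleDist-⊕ (u ⊕ 1 ⊕ 1) (<-trans (n<1+n (n + j)) k<N) ⟨
    d (u ⊕ 1 ⊕ 1) (u ⊕ 1 ⊕ 1 ⊕ (n + j))    ≡⟨ cong (d (u ⊕ 1 ⊕ 1)) (⊕-assoc (u ⊕ 1) 1 (n + j)) ⟩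
    d (u ⊕ 1 ⊕ 1) (u ⊕ 1 ⊕ suc (n + j))    ∎)
    where open ≤-Reasoning

  ecc≤n : ∀ S v → ecc N S v ≤ n
  ecc≤n S v = ecc-least S v (λ x _ → d≤n v x)

  centerOf≡⊤ : ∀ {S} → (∀ v → n ≤ ecc N S v) → centerOf N S ≡ ⊤
  centerOf≡⊤ {S} n≤ecc = ⊆-antisym ⊆⊤ (λ {v} _ → centerOf⁺ S (λ x → ≤-trans (ecc≤n S v) (n≤ecc x)))

  centerOf-⊤ : centerOf N ⊤ ≡ ⊤
  centerOf-⊤ = centerOf≡⊤ (λ v → subst (_≤ ecc N ⊤ v) (d-antipode v) (ecc-upper ⊤ v ∈⊤))

  consecutive-centers⇒⊤ : ∀ {S} → Nonempty S → ∀ i →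
    i ∈ centerOf N S → i ⊕ 1 ∈ centerOf N S → i ⊕ 1 ⊕ 1 ∈ centerOf N S → centerOf N S ≡ ⊤
  consecutive-centers⇒⊤ {S} ne i i∈C w∈C s∈C = centerOf≡⊤ (λ x → ≤-trans n≤ecc[w] (centerOf⁻ S w∈C x))
    where
    w = i ⊕ 1
    n≤ecc[w] : n ≤ ecc N S w
    n≤ecc[w] with ecc-attained S w ne
    ... | y , y∈S , ecc≡d = ≮⇒≥ λ ecc<n →
      Sum.[ nearer i i∈C , nearer (w ⊕ 1) s∈C ]′ (farther-neighbour i y (subst (_< n) ecc≡d ecc<n))
      where
      nearer : ∀ u → u ∈ centerOf N S → ¬ (d w y < d u y)
      nearer u u∈C d<d = <⇒≱ d<d (begin
        d u y        ≤⟨ ecc-upper S u y∈S ⟩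
        ecc N S u    ≤⟨ centerOf⁻ S u∈C w ⟩
        ecc N S w    ≡⟨ ecc≡d ⟩
        d w y        ∎)
        where open ≤-Reasoning

  centerOf≡⊤⊎noThreeConsec : ∀ {S} → Nonempty S → centerOf N S ≡ ⊤ ⊎ T (noThreeConsecᵇ (centerOf N S))
  centerOf≡⊤⊎noThreeConsec {S} ne with ≡-dec _≟ᴮ_ (centerOf N S) ⊤
  ... | yes C≡⊤ = inj₁ C≡⊤
  ... | no  C≢⊤ = inj₂ (noThreeConsecᵇ⁺ λ i (i∈C , w∈C , s∈C) →
                    C≢⊤ (consecutive-centers⇒⊤ ne i i∈C w∈C s∈C))

  neighbour-outside : ∀ {A v} → T (noThreeConsecᵇ A) → v ∈ A → ∃ λ t → t ∉ A × d v t ≡ 1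
  neighbour-outside {A} {v} t v∈A with noThreeConsecᵇ⁻ {A = A} t (predecessor v)
  ... | inj₁ p∉A         = predecessor v , p∉A , trans (d-sym v _)
                             (subst (λ y → d (predecessor v) y ≡ 1) (predecessor-⊕1 v) (d-⊕1 (predecessor v)))
  ... | inj₂ (inj₁ v∉A)  = ⊥-elim (subst (_∉ A) (predecessor-⊕1 v) v∉A v∈A)
  ... | inj₂ (inj₂ s∉A)  = v ⊕ 1 , subst (λ y → y ⊕ 1 ∉ A) (predecessor-⊕1 v) s∉A , d-⊕1 v

  antipodes : Subset N → Subset N
  antipodes B = tabulate (λ x → antipode x ∈ᵇ B)

  antipode-∉⇒∈ : ∀ {A t} → t ∉ A → antipode t ∈ antipodes (∁ A)
  antipode-∉⇒∈ {A} {t} t∉A =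
    ∈-tabulate⁺ (∈⇒∈ᵇ (x∉p⇒x∈∁p (subst (_∉ A) (sym (antipode-involutive t)) t∉A)))

  ∈antipodes∁⇒∉ : ∀ {A x} → x ∈ antipodes (∁ A) → antipode x ∉ A
  ∈antipodes∁⇒∉ x∈S = x∈∁p⇒x∉p (∈ᵇ⇒∈ (∈-tabulate⁻ x∈S))

  centerOf-antipodes∁ : ∀ {A} → T (noThreeConsecᵇ A) → Nonempty A → centerOf N (antipodes (∁ A)) ≡ A
  centerOf-antipodes∁ {A} t ne = centerOf≡minimisers ne ecc-inside ecc-outside
    where
    S = antipodes (∁ A)
    ecc-outside : ∀ {v} → v ∉ A → n ∸ 1 < ecc N S v
    ecc-outside {v} v∉A =
      <-≤-trans (∸-monoʳ-< (s≤s z≤n) (>-nonZero⁻¹ n))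
                (subst (_≤ ecc N S v) (d-antipode v) (ecc-upper S v (antipode-∉⇒∈ v∉A)))
    ecc-inside : ∀ {v} → v ∈ A → ecc N S v ≡ n ∸ 1
    ecc-inside {v} v∈A = ≤-antisym (ecc-least S v near) far
      where
      near : ∀ x → x ∈ S → d v x ≤ n ∸ 1
      near x x∈S = m+n≤o⇒m≤o∸n (d v x) (subst (d v x + 1 ≤_) (d+d-antipode v x)
        (+-monoʳ-≤ (d v x) (d-pos λ v≡x̄ → ∈antipodes∁⇒∉ x∈S (subst (_∈ A) v≡x̄ v∈A))))
      far : n ∸ 1 ≤ ecc N S v
      far with neighbour-outside t v∈A
      ... | u , u∉A , d≡1 = subst (_≤ ecc N S v) d≡n∸1 (ecc-upper S v (antipode-∉⇒∈ u∉A))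
        where
        d≡n∸1 : d v (antipode u) ≡ n ∸ 1
        d≡n∸1 = trans (sym (m+n∸m≡n 1 _))
                      (cong (_∸ 1) (trans (cong (_+ d v (antipode u)) (sym d≡1)) (d+d-antipode v u)))

  isCenterSet⇔ : ∀ {A} → T (isCenterSetᵇ N A) ⇔ (A ≡ ⊤ ⊎ Nonempty A × T (noThreeConsecᵇ A))
  isCenterSet⇔ {A} = mk⇔ to from
    where
    to : T (isCenterSetᵇ N A) → A ≡ ⊤ ⊎ Nonempty A × T (noThreeConsecᵇ A)
    to t with isCenterSetᵇ⁻ {N} {A} t
    ... | S , ne , refl = Sum.map₂ (centerOf-nonempty S (proj₁ ne) ,_) (centerOf≡⊤⊎noThreeConsec ne)
    from : A ≡ ⊤ ⊎ Nonempty A × T (noThreeConsecᵇ A) → T (isCenterSetᵇ N A)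
    from (inj₁ refl) = isCenterSetᵇ⁺ (0 mod N , ∈⊤) centerOf-⊤
    from (inj₂ (ne@(a , a∈A) , t)) with neighbour-outside t a∈A
    ... | u , u∉A , _ = isCenterSetᵇ⁺ (antipode u , antipode-∉⇒∈ u∉A) (centerOf-antipodes∁ t ne)

  ⌊4n/3⌋ : ℕ
  ⌊4n/3⌋ = (4 * n) / 3

  noThreeConsec⇒∣A∣≤⌊4n/3⌋ : ∀ {A} → T (noThreeConsecᵇ A) → ∣ A ∣ ≤ ⌊4n/3⌋
  noThreeConsec⇒∣A∣≤⌊4n/3⌋ {A} t = subst (_≤ ⌊4n/3⌋) (m*n/n≡m ∣ A ∣ 3) (/-monoˡ-≤ 3 ∣A∣*3≤4n)
    where
    ∣A∣*3≤4n : ∣ A ∣ * 3 ≤ 4 * n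
    ∣A∣*3≤4n = subst₂ _≤_ (*-comm 3 ∣ A ∣) (sym (*-assoc 2 2 n)) (noThreeConsec⇒3∣A∣≤2N {N} {A = A} t)

  noThreeConsec⇒∣A∣≢N : ∀ {A} → T (noThreeConsecᵇ A) → ∣ A ∣ ≢ N
  noThreeConsec⇒∣A∣≢N {A} t ∣A∣≡N = <⇒≱ ≤-refl (*-cancelʳ-≤ 3 2 N 3N≤2N)
    where
    3N≤2N : 3 * N ≤ 2 * N
    3N≤2N = subst (λ s → 3 * s ≤ 2 * N) ∣A∣≡N (noThreeConsec⇒3∣A∣≤2N {N} {A = A} t)

  module _ (A : Subset N) where

    fibre : ℕ → Bool
    fibre k = (∣ A ∣ ≡ᵇ k) ∧ noThreeConsecᵇ A

    fibres : ℕ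
    fibres = sumFrom1 ⌊4n/3⌋ (𝟙 ∘ fibre)

    fibres-vanish : ¬ (Nonempty A × T (noThreeConsecᵇ A)) → fibres ≡ 0
    fibres-vanish ¬ne×t = sumFrom1-vanish ⌊4n/3⌋ λ k 1≤k _ → 𝟙-¬T λ h →
      let ∣A∣≡k , t = Equivalence.to T-∧ h in
      ¬ne×t (∣p∣>0⇒nonempty (subst (0 <_) (sym (≡ᵇ⇒≡ _ _ ∣A∣≡k)) 1≤k) , t)

    fibres-single : Nonempty A × T (noThreeConsecᵇ A) → fibres ≡ 1
    fibres-single (ne , t) =
      trans (sumFrom1-δ ⌊4n/3⌋ (nonempty⇒∣p∣>0 ne) (noThreeConsec⇒∣A∣≤⌊4n/3⌋ {A} t) fibre-off)
            (𝟙-T (Equivalence.from T-∧ (≡⇒≡ᵇ ∣ A ∣ ∣ A ∣ refl , t)))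
      where
      fibre-off : ∀ k → k ≢ ∣ A ∣ → 𝟙 (fibre k) ≡ 0
      fibre-off k k≢∣A∣ = 𝟙-¬T (k≢∣A∣ ∘ sym ∘ ≡ᵇ⇒≡ _ _ ∘ proj₁ ∘ Equivalence.to T-∧)

    centerSet-indicator : 𝟙 (isCenterSetᵇ N A) ≡ 𝟙 (∣ A ∣ ≡ᵇ N) + fibres
    centerSet-indicator with ∣ A ∣ ≟ N | nonempty? A ×-dec T? (noThreeConsecᵇ A)
    ... | yes ∣A∣≡N | yes (_ , t) = ⊥-elim (noThreeConsec⇒∣A∣≢N {A} t ∣A∣≡N)
    ... | yes ∣A∣≡N | no ¬ne×t = begin
      𝟙 (isCenterSetᵇ N A)   ≡⟨ 𝟙-T (Equivalence.from isCenterSet⇔ (inj₁ (∣p∣≡n⇒p≡⊤ ∣A∣≡N))) ⟩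
      1 + 0                  ≡⟨ cong₂ _+_ (𝟙-T (≡⇒≡ᵇ _ _ ∣A∣≡N)) (fibres-vanish ¬ne×t) ⟨
      𝟙 (∣ A ∣ ≡ᵇ N) + fibres ∎
      where open ≡-Reasoning
    ... | no ∣A∣≢N | yes ne×t = begin
      𝟙 (isCenterSetᵇ N A)   ≡⟨ 𝟙-T (Equivalence.from isCenterSet⇔ (inj₂ ne×t)) ⟩
      0 + 1                  ≡⟨ cong₂ _+_ (𝟙-¬T (∣A∣≢N ∘ ≡ᵇ⇒≡ _ _)) (fibres-single ne×t) ⟨
      𝟙 (∣ A ∣ ≡ᵇ N) + fibres ∎
      where open ≡-Reasoning
    ... | no ∣A∣≢N | no ¬ne×t = begin
      𝟙 (isCenterSetᵇ N A)   ≡⟨ 𝟙-¬T (Sum.[ ∣A∣≢N ∘ ∣⊤∣ , ¬ne×t ]′ ∘ Equivalence.to isCenterSet⇔) ⟩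
      0 + 0                  ≡⟨ cong₂ _+_ (𝟙-¬T (∣A∣≢N ∘ ≡ᵇ⇒≡ _ _)) (fibres-vanish ¬ne×t) ⟨
      𝟙 (∣ A ∣ ≡ᵇ N) + fibres ∎
      where
      open ≡-Reasoning
      ∣⊤∣ : A ≡ ⊤ → ∣ A ∣ ≡ N
      ∣⊤∣ refl = ∣⊤∣≡n N

mainTheorem17 : (n : ℕ) → 2 ≤ n →
    centerNumber (2 * n) ≡ sumFrom1 ((4 * n) / 3) (λ k → R (2 * n) k) + 1
mainTheorem17 n 2≤n = begin
  centerNumber N
    ≡⟨ countᵇ-decompose _ _ (λ k A → fibre A k) ⌊4n/3⌋ centerSet-indicator (subsets N) ⟩
  countᵇ (λ A → ∣ A ∣ ≡ᵇ N) (subsets N) + sumFrom1 ⌊4n/3⌋ (R N)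
    ≡⟨ cong (_+ sumFrom1 ⌊4n/3⌋ (R N)) (countᵇ-full-subsets N) ⟩
  1 + sumFrom1 ⌊4n/3⌋ (R N)
    ≡⟨ +-comm 1 _ ⟩
  sumFrom1 ⌊4n/3⌋ (R N) + 1 ∎
  where
  open ≡-Reasoning
  instance
    -- only n ≠ 0 is needed
    n-nonZero : NonZero n
    n-nonZero = >-nonZero (<-≤-trans (s≤s z≤n) 2≤n)
  open EvenCycle n
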